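{- For integers $C\geq 3$ and $k\in\{1,\dots,C-2\}$, $\gamma_{P,k}(WKP_{(C,2)})\geq C-k$.
   Context: For a graph $G$, $S\subseteq V(G)$ and an integer $k\ge 0$, define $\mathcal{P}^0_{G,k}(S)=N_G[S]$ (closed neighbourhood of $S$) and $\mathcal{P}^{i+1}_{G,k}(S)=\bigcup\{N_G[v] : v\in \mathcal{P}^i_{G,k}(S),\ |N_G[v]\setminus \mathcal{P}^i_{G,k}(S)|\le k\}$. These sets increase and stabilize at a set $\mathcal{P}^\infty_{G,k}(S)$. A $k$-power dominating set ($k$-PDS) is a set $S$ with $\mathcal{P}^\infty_{G,k}(S)=V(G)$, and $\gamma_{P,k}(G)$ is the minimum cardinality of a $k$-PDS of $G$. Let $[C]_0=\{0,\dots,C-1\}$. The WK-Pyramid network $WKP_{(C,L)}$ has vertex set $\{(r,(a_r a_{r-1}\cdots a_1)) : r\in\{1,\dots,L\},\ a_i\in[C]_0\}\cup\{(0,(1))\}$; a vertex $(r,(a_r\cdots a_1))$ is said to be at level $r$. The vertex $(0,(1))$ is adjacent to every vertex at level $1$. A vertex $(r,(a_r\cdots a_1))$ with $r>0$ is adjacent to: (1) the vertices $(r,(a_r\cdots a_2 b))$ with $b\in[C]_0$, $b\ne a_1$; (2) the vertex $(r,(a_r\cdots a_{j+1}a_{j-1}(a_j)^{j-1}))$ if there is a $j$ with $2\le j\le r$, $a_{j-1}=a_{j-2}=\cdots=a_1$ and $a_j\ne a_{j-1}$, where $(a_j)^{j-1}$ denotes $a_j$ repeated $j-1$ times; (3)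 the vertices $(r+1,(a_r\cdots a_1 b))$ for $b\in[C]_0$ (when $r<L$); (4) the vertex $(r-1,(a_r\cdots a_2))$ (for $r=1$ this is $(0,(1))$). -}

module Defs where

open import Data.Nat using (ℕ; zero; suc; _≤_)
open import Data.Fin using (Fin)
open import Data.List using (List; []; _∷_; length; replicate; _++_)
open import Data.List.Membership.Propositional using (_∈_)
open import Data.Product using (Σ; Σ-syntax; _×_; proj₁)
open import Data.Sum using (_⊎_)
open import Relation.Binary.PropositionalEquality using (_≡_)
open import Relation.Nullary using (¬_)

-- A word (a_r a_{r-1} ... a_1) over [C]_0 = Fin C is stored as the list
-- a_1 ∷ a_2 ∷ ... ∷ a_r ∷ []  (least significant digit a_1 FIRST).
-- The vertex (r,(a_r...a_1)) of WKP_(C,L) is a word of length r ≤ L;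
-- the apex (0,(1)) is the empty word [].
Vertex : ℕ → ℕ → Set
Vertex C L = Σ[ w ∈ List (Fin C) ] (length w ≤ L)

data Step {C : ℕ} : List (Fin C) → List (Fin C) → Set where
  sib    : ∀ {a b t} → ¬ a ≡ b → Step (a ∷ t) (b ∷ t)
  -- (2) a_1 = ... = a_{j-1} = x, a_j = y ≠ x (m = j-1 ≥ 1):
  --     (… a_{j+1} y x^{j-1}) ~ (… a_{j+1} x y^{j-1})
  swap   : ∀ {m x y t} → 1 ≤ m → ¬ y ≡ x →
           Step (replicate m x ++ (y ∷ t)) (replicate m y ++ (x ∷ t))
  -- (3) child (a_r...a_1 b); length bound enforced by Vertex
  child  : ∀ {b t} → Step t (b ∷ t)
  -- (4) parent (a_r ... a_2); for r = 1 this is the apex [].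
  --     (Together with child, also covers the apex–level-1 edges.)
  parent : ∀ {b t} → Step (b ∷ t) t

Adj : ∀ {C L} → Vertex C L → Vertex C L → Set
Adj u v = Step (proj₁ u) (proj₁ v)

N[_] : ∀ {C L} → Vertex C L → Vertex C L → Set
N[ v ] u = u ≡ v ⊎ Adj v u

AtMost : ∀ {A : Set} → ℕ → (A → Set) → Set
AtMost {A} k P = Σ[ xs ∈ List A ] (length xs ≤ k × (∀ a → P a → a ∈ xs))

Obs : (C L k : ℕ) → List (Vertex C L) → ℕ → Vertex C L → Set
Obs C L k S zero u = Σ[ s ∈ Vertex C L ] (s ∈ S × N[ s ] u)
Obs C L k S (suc i) u =
  Σ[ v ∈ Vertex C L ]
    ( Obs C L k S i v
    × AtMost k (λ w → N[ v ] w × ¬ Obs C L k S i w)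
    × N[ v ] u )

IsKPDS : (C L k : ℕ) → List (Vertex C L) → Set
IsKPDS C L k S = ∀ u → Σ[ i ∈ ℕ ] Obs C L k S i u

module Submission where

-- Levels 1 and 2 of WKP_(C,2) split into C blocks {(1,(a))} ∪ {(2,(a b)) | b ∈ [C]_0}.
-- Call a block hit if S contains one of its vertices.  If |S| + k < C then some
-- block a is unhit, and in an unhit block a vertex (2,(a b)) can only become
-- observed when b is a hit block: initially it can only be dominated through its
-- mirror (2,(b a)), and a forcing step from inside block a is impossible because
-- every (2,(a b)) with b unhit is an unobserved neighbour, and there are at least
-- C − |S| > k of them.  Applied to (2,(a a)) this is a contradiction, so every
-- block is hit and C ≤ |S|, contradicting |S| + k < C again.

open import Defs
open import Data.Nat using (ℕ; zero; suc; _≤_; _<_; _∸_; _+_; z≤n; s≤s; _≤?_)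
open import Data.Nat.Properties using (≤-irrelevant; ≤-refl; ≤-trans; ≤-reflexive; <-irrefl; ≰⇒>; +-monoˡ-≤; m≤n+m; m≤n+o⇒m∸n≤o; module ≤-Reasoning)
open import Data.Fin using (Fin; _≟_) renaming (zero to fzero)
open import Data.Fin.Properties using (injective⇒≤)
open import Data.List using (List; []; _∷_; length; map; _++_; lookup)
open import Data.List.Properties using (length-map; length-++)
open import Data.List.Relation.Unary.Any using (index)
open import Data.List.Relation.Unary.Any.Properties using (lookup-index)
open import Data.List.Relation.Unary.Unique.Propositional using (Unique)
open import Data.List.Membership.Propositional using (_∈_; _∉_)
open import Data.List.Membership.Propositional.Properties using (∈-map⁺; ∈-++⁺ˡ; ∈-++⁺ʳ)
open import Data.Product using (_×_; _,_; proj₁)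
open import Data.Sum using (inj₁; inj₂)
open import Relation.Nullary using (¬_; yes; no; contradiction)
open import Relation.Nullary.Decidable using (decidable-stable)
open import Relation.Binary.PropositionalEquality using (_≡_; refl; sym; cong; cong₂; module ≡-Reasoning)

covering⇒≤length : ∀ {n} (ys : List (Fin n)) → (∀ x → x ∈ ys) → n ≤ length ys
covering⇒≤length ys cover = injective⇒≤ position-injective
  where
  position-injective : ∀ {x y} → index (cover x) ≡ index (cover y) → x ≡ y
  position-injective {x} {y} eq = begin
    x                           ≡⟨ lookup-index (cover x) ⟩
    lookup ys (index (cover x)) ≡⟨ cong (lookup ys) eq ⟩
    lookup ys (index (cover y)) ≡⟨ lookup-index (cover y) ⟨
    y                           ∎
    where open ≡-Reasoning

vertex-≡ : ∀ {C L} {u v : Vertex C L} → proj₁ u ≡ proj₁ v → u ≡ v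
vertex-≡ {u = w , p} {v = .w , q} refl = cong (w ,_) (≤-irrelevant p q)

module _ {C : ℕ} where

  vertex₁ : Fin C → Vertex C 2
  vertex₁ a = a ∷ [] , s≤s z≤n

  vertex₂ : Fin C → Fin C → Vertex C 2
  vertex₂ a b = b ∷ a ∷ [] , ≤-refl

  data LeafNeighbour (a b : Fin C) (v : Vertex C 2) : Set where
    sibling : ∀ c → v ≡ vertex₂ a c → LeafNeighbour a b v
    parent  : v ≡ vertex₁ a → LeafNeighbour a b v
    mirror  : v ≡ vertex₂ b a → LeafNeighbour a b v

  adjacent-to-leaf : ∀ {a b u} (v : Vertex C 2) → Step (proj₁ v) u → u ≡ b ∷ a ∷ [] → LeafNeighbour a b v
  adjacent-to-leaf (_ , _)            (sib {a = c} _)                 refl = sibling c (vertex-≡ refl)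
  adjacent-to-leaf (_ , _)            (swap {m = suc zero} _ _)       refl = mirror (vertex-≡ refl)
  adjacent-to-leaf (_ , _)            (swap {m = suc (suc zero)} _ _)    ()
  adjacent-to-leaf (_ , _)            (swap {m = suc (suc (suc _))} _ _) ()
  adjacent-to-leaf (_ , _)            child                           refl = parent (vertex-≡ refl)
  adjacent-to-leaf (_ , s≤s (s≤s ())) parent                          refl

  closed-neighbour-of-leaf : ∀ {a b} v → N[ v ] (vertex₂ a b) → LeafNeighbour a b v
  closed-neighbour-of-leaf v (inj₁ eq) = sibling _ (sym eq)
  closed-neighbour-of-leaf v (inj₂ st) = adjacent-to-leaf v st refl

  leaves-near-sibling : ∀ {a} c b → N[ vertex₂ a c ] (vertex₂ a b)
  leaves-near-sibling c b with c ≟ b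
  ... | yes refl = inj₁ refl
  ... | no c≢b   = inj₂ (sib c≢b)

  leaves-near-parent : ∀ {a} b → N[ vertex₁ a ] (vertex₂ a b)
  leaves-near-parent b = inj₂ child

-- The apex lies in no block; defaultBlock is assigned to it, harmlessly, since it has no level-2 neighbour.
module Blocks (C k : ℕ) (defaultBlock : Fin C) (S : List (Vertex C 2)) where

  open import Data.List.Membership.DecPropositional (_≟_ {C}) using (_∈?_)

  block : Vertex C 2 → Fin C
  block ([]        , _) = defaultBlock
  block (a ∷ []    , _) = a
  block (_ ∷ a ∷ _ , _) = a

  hitBlocks : List (Fin C)
  hitBlocks = map block S

  hit : ∀ {s} → s ∈ S → block s ∈ hitBlocks
  hit = ∈-map⁺ block

  lastDigit : Fin C → Vertex C 2 → Fin C
  lastDigit a ([]    , _) = a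
  lastDigit _ (b ∷ _ , _) = b

  leaves-of-unhit-blocks : ∀ a (xs : List (Vertex C 2)) → (∀ b → b ∉ hitBlocks → vertex₂ a b ∈ xs) →
                           C ≤ length xs + length S
  leaves-of-unhit-blocks a xs leaves = begin
    C                                                   ≤⟨ covering⇒≤length ys cover ⟩
    length ys                                           ≡⟨ length-++ (map (lastDigit a) xs) ⟩
    length (map (lastDigit a) xs) + length hitBlocks    ≡⟨ cong₂ _+_ (length-map _ xs) (length-map block S) ⟩
    length xs + length S                                ∎
    where
    open ≤-Reasoning
    ys : List (Fin C)
    ys = map (lastDigit a) xs ++ hitBlocks
    cover : ∀ b → b ∈ ys
    cover b with b ∈? hitBlocks
    ... | yes b∈ = ∈-++⁺ʳ _ b∈
    ... | no  b∉ = ∈-++⁺ˡ (∈-map⁺ (lastDigit a) (leaves b b∉))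

  module _ (few : k + length S < C) where

    crowded-block : ∀ {a v} {Observed : Vertex C 2 → Set} →
                    (∀ {b} → Observed (vertex₂ a b) → b ∈ hitBlocks) →
                    (∀ b → N[ v ] (vertex₂ a b)) →
                    ¬ AtMost k (λ w → N[ v ] w × ¬ Observed w)
    crowded-block {a} observed⇒hit near (xs , length≤k , unobserved∈xs) =
      <-irrefl refl (≤-trans few (≤-trans (leaves-of-unhit-blocks a xs leaf∈xs) (+-monoˡ-≤ (length S) length≤k)))
      where
      leaf∈xs : ∀ b → b ∉ hitBlocks → vertex₂ a b ∈ xs
      leaf∈xs b b∉ = unobserved∈xs _ (near b , λ obs → b∉ (observed⇒hit obs))

    observed-in-unhit-block : ∀ i {a b} → a ∉ hitBlocks → Obs C 2 k S i (vertex₂ a b) → b ∈ hitBlocks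
    observed-in-unhit-block zero a∉ (s , s∈S , near) with closed-neighbour-of-leaf s near
    ... | sibling c refl = contradiction (hit s∈S) a∉
    ... | parent refl    = contradiction (hit s∈S) a∉
    ... | mirror refl    = hit s∈S
    observed-in-unhit-block (suc i) {b = b} a∉ (v , obs , few-unobserved , near)
      with closed-neighbour-of-leaf v near
    ... | sibling c refl = contradiction few-unobserved
                             (crowded-block (observed-in-unhit-block i a∉) (leaves-near-sibling c))
    ... | parent refl    = contradiction few-unobserved
                             (crowded-block (observed-in-unhit-block i a∉) leaves-near-parent)
    ... | mirror refl with b ∈? hitBlocks
    ...   | yes b∈ = b∈
    ...   | no  b∉ = contradiction (observed-in-unhit-block i b∉ obs) a∉

    every-block-hit : IsKPDS C 2 k S → ∀ a → a ∈ hitBlocks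
    every-block-hit kpds a with i , obs ← kpds (vertex₂ a a) =
      decidable-stable (a ∈? hitBlocks) (λ a∉ → a∉ (observed-in-unhit-block i a∉ obs))

kpds-size : ∀ C k (S : List (Vertex C 2)) → IsKPDS C 2 k S → C ≤ k + length S
kpds-size zero    _ _ _ = z≤n
kpds-size (suc n) k S kpds with suc n ≤? k + length S
... | yes bound = bound
... | no  ¬bound = contradiction (≤-trans all-hit (m≤n+m (length S) k)) ¬bound
  where
  open Blocks (suc n) k fzero S
  all-hit : suc n ≤ length S
  all-hit = ≤-trans (covering⇒≤length hitBlocks (every-block-hit (≰⇒> ¬bound) kpds)) (≤-reflexive (length-map block S))

-- The bound holds for every k.
mainTheorem3 : (C k : ℕ) → 3 ≤ C → 1 ≤ k → k ≤ C ∸ 2 →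
    (S : List (Vertex C 2)) → Unique S → IsKPDS C 2 k S → C ∸ k ≤ length S
mainTheorem3 C k _ _ _ S _ kpds = m≤n+o⇒m∸n≤o C k (kpds-size C k S kpds)
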